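{- Let $n\geq 4$ and let $\mathcal{I}=(a_1,\dots,a_n)$ be an ordered irreducible signature of $Q_n$. Suppose that for some $i\in\{2,\dots,n-1\}$ we have $a_{i+1}-a_i\leq 1$. Then $\varepsilon_i(\mathcal{I})\geq 2$.
   Context: $[n]=\{1,\dots,n\}$. $Q_n$: vertices the subsets of $[n]$, edge between $X,Y$ iff $X\oplus Y=\{i\}$ for a single $i$ (the direction). A signature of $Q_n$ is a tuple $(a_1,\dots,a_n)$ with $a_i$ the number of edges in direction $i$ of some spanning tree; it is ordered if $a_1\le\dots\le a_n$, and irreducible if no proper nonempty $R\subseteq[n]$ has $\sum_{i\in R}a_i=2^{|R|}-1$. For ordered $\mathcal{I}$, $\varepsilon_i(\mathcal{I})=\sum_{j=1}^i a_j-(2^i-1)$. -}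

module Defs where

open import Data.Nat using (ℕ; zero; suc; _+_; _∸_; _^_; _≤_; _<ᵇ_)
open import Data.Bool using (not; if_then_else_)
open import Data.Fin as Fin using (Fin; toℕ)
open import Data.Fin.Subset using (Subset; _∉_; _∈_; Nonempty; ⊤; ∣_∣; inside)
open import Data.Vec using (Vec; updateAt; lookup; tabulate; sum)
open import Data.List using (List; length; filter)
import Data.List.Membership.Propositional as LMem
open import Data.List.Relation.Unary.All using (All)
open import Data.List.Relation.Unary.Unique.Propositional using (Unique)
open import Data.Product using (Σ; _×_; _,_; proj₁; proj₂)
open import Data.Sum using (_⊎_)
open import Data.Integer as ℤ using (ℤ; +_; _-_)
open import Relation.Binary.PropositionalEquality using (_≡_; _≢_)
open import Relation.Nullary using (¬_)

-- Vertices of Q_n: subsets of [n] (coordinates indexed by Fin n, i.e. 0-based).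
Vertex : ℕ → Set
Vertex n = Subset n

_⊕_ : ∀ {n} → Vertex n → Fin n → Vertex n
X ⊕ i = updateAt X i not

-- An edge of Q_n is represented as (X , i): the edge {X , X ⊕ {i}} in direction i.
-- Canonical representation (used for spanning trees): i ∉ X (X is the lower endpoint).
Edge : ℕ → Set
Edge n = Vertex n × Fin n

Canonical : ∀ {n} → Edge n → Set
Canonical (X , i) = i ∉ X

data Reach {n : ℕ} (P : Edge n → Set) (X : Vertex n) : Vertex n → Set where
  here : Reach P X X
  step : ∀ {Y Z W i} → Reach P X Y → P (W , i) →
         ((Y ≡ W × Z ≡ W ⊕ i) ⊎ (Y ≡ W ⊕ i × Z ≡ W)) → Reach P X Z

-- T (a list of distinct canonical edges) is a spanning tree of Q_n:
-- connected on all vertices, and acyclic (no edge of T lies on a cycle, i.e.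
-- removing any edge of T disconnects its endpoints).
record SpanningTree {n : ℕ} (T : List (Edge n)) : Set where
  field
    distinct  : Unique T
    canonical : All Canonical T
    connected : ∀ (X Y : Vertex n) → Reach (λ e → e LMem.∈ T) X Y
    acyclic   : ∀ (e : Edge n) → e LMem.∈ T →
                ¬ Reach (λ f → (f LMem.∈ T) × (f ≢ e)) (proj₁ e) (proj₁ e ⊕ proj₂ e)

count : ∀ {n} → List (Edge n) → Fin n → ℕ
count T i = length (filter (λ e → proj₂ e Fin.≟ i) T)

-- a (with a(j) = a_{j+1}, 0-based) is a signature of Q_n
IsSignature : ∀ {n} → (Fin n → ℕ) → Set
IsSignature {n} a = Σ (List (Edge n)) λ T → SpanningTree T × (∀ i → a i ≡ count T i)

Ordered : ∀ {n} → (Fin n → ℕ) → Set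
Ordered a = ∀ i j → i Fin.≤ j → a i ≤ a j

sumOver : ∀ {n} → Subset n → (Fin n → ℕ) → ℕ
sumOver R a = sum (tabulate λ i → if lookup R i then a i else 0)

Irreducible : ∀ {n} → (Fin n → ℕ) → Set
Irreducible {n} a = ∀ (R : Subset n) → Nonempty R → R ≢ ⊤ → sumOver R a ≢ 2 ^ ∣ R ∣ ∸ 1

-- ε_i(I) = Σ_{j=1}^{i} a_j − (2^i − 1)  (paper's 1-based i; in ℤ)
ε : ∀ {n} → (Fin n → ℕ) → ℕ → ℤ
ε a i = + sum (tabulate λ j → if toℕ j <ᵇ i then a j else 0) - + (2 ^ i ∸ 1)

-- Zeroing all coordinates but the first k maps a spanning tree of Q_n onto a
-- connected graph on the 2^k vertices of Q_k whose edges are the tree edges in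
-- the first k directions, so a_1 + … + a_k ≥ 2^k − 1; irreducibility makes this
-- strict for 0 < k < n, i.e. ε_k ≥ 1. If ε_i = 1, then a_i ≤ 2^(i−1) (as
-- ε_(i−1) ≥ 1), hence a_(i+1) ≤ 2^(i−1) + 1 and a_1 + … + a_(i+1) ≤ 3·2^(i−1) + 1,
-- which is below 2^(i+1) − 1 unless i = 2; for i = 2 strictness at k = 3 < n
-- demands a sum ≥ 8 > 7.

module Submission where

open import Defs
open import Data.Nat using (ℕ; suc; _∸_; _≤_)
open import Data.Fin using (Fin; toℕ)
open import Data.Integer as ℤ using (+_)
open import Relation.Binary.PropositionalEquality using (_≡_)

open import Level using (Level)
open import Function using (id; _∘_)
open import Data.Empty using (⊥)
open import Data.Bool using (true; false; if_then_else_)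
import Data.Bool as Bool
open import Data.Nat using (zero; _+_; _*_; _^_; _<_; _<ᵇ_; z≤n; s≤s; s≤s⁻¹)
open import Data.Nat.Properties
open import Data.Nat.Tactic.RingSolver using (solve-∀)
import Data.Integer.Properties as ℤP
open import Algebra.Properties.CommutativeSemigroup +-commutativeSemigroup using (interchange)
import Data.Fin as Fin
open import Data.Fin.Properties using (toℕ<n)
open import Data.Fin.Subset as Subset using (Subset; ⊤; Nonempty; ∣_∣)
open import Data.Product using (_×_; _,_; proj₂)
open import Data.Sum using (_⊎_; inj₁; inj₂)
open import Data.Vec using ([]; _∷_; here; tabulate; sum)
open import Data.Vec.Properties using (≡-dec; tabulate-cong; lookup∘tabulate; ∷-injectiveʳ)
open import Data.List using (List; []; _∷_; [_]; length; map; filter; _++_)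
open import Data.List.Properties using (filter-all; filter-accept; filter-++; length-map; length-++)
open import Data.List.Membership.Propositional using (_∈_)
open import Data.List.Membership.Propositional.Properties using (∈-map⁺; ∈-map⁻; ∈-filter⁺)
open import Data.List.Relation.Unary.Any using (here; there)
open import Data.List.Relation.Unary.All as All using (All; []; _∷_)
import Data.List.Relation.Unary.All.Properties as All
open import Data.List.Relation.Unary.AllPairs using ([]; _∷_)
open import Data.List.Relation.Unary.Unique.Propositional using (Unique)
import Data.List.Relation.Unary.Unique.Propositional.Properties as Unique
open import Relation.Binary.Construct.Closure.ReflexiveTransitive using (Star; _◅_; _◅◅_) renaming (ε to ε⋆)
open import Relation.Binary.Construct.Closure.Symmetric using (SymClosure; fwd; bwd)
open import Relation.Binary.Definitions using (DecidableEquality)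
open import Relation.Binary.PropositionalEquality using (_≢_; refl; sym; trans; cong; cong₂; subst; module ≡-Reasoning)
open import Relation.Nullary using (yes; no; does; ¬_; contradiction)
open import Relation.Nullary.Decidable using (dec-true; dec-false)
open import Relation.Unary using (Pred; Decidable)

private
  variable
    ℓ ℓ′ : Level
    A : Set ℓ

length-filter-∷ : {P : Pred A ℓ′} (P? : Decidable P) (x : A) (xs : List A) →
                  length (filter P? xs) ≤ length (filter P? (x ∷ xs))
length-filter-∷ P? x xs with does (P? x)
... | true  = n≤1+n _
... | false = ≤-refl

length-filter-⊆-∪ : {P Q R : Pred A ℓ′} (P? : Decidable P) (Q? : Decidable Q) (R? : Decidable R) →
                    (∀ {x} → P x → Q x ⊎ R x) → ∀ xs →
                    length (filter P? xs) ≤ length (filter Q? xs) + length (filter R? xs)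
length-filter-⊆-∪ P? Q? R? P⊆Q∪R [] = z≤n
length-filter-⊆-∪ P? Q? R? P⊆Q∪R (x ∷ xs) with ih ← length-filter-⊆-∪ P? Q? R? P⊆Q∪R xs | P? x
... | no _  = ≤-trans ih (+-mono-≤ (length-filter-∷ Q? x xs) (length-filter-∷ R? x xs))
... | yes px with P⊆Q∪R px
...   | inj₁ qx = begin
  suc (length (filter P? xs))                            ≤⟨ s≤s (≤-trans ih (+-monoʳ-≤ _ (length-filter-∷ R? x xs))) ⟩
  suc (length (filter Q? xs)) + length (filter R? (x ∷ xs)) ≡⟨ cong (_+ _) (cong length (filter-accept Q? qx)) ⟨
  length (filter Q? (x ∷ xs)) + length (filter R? (x ∷ xs))  ∎
  where open ≤-Reasoning
...   | inj₂ rx = begin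
  suc (length (filter P? xs))                            ≤⟨ s≤s (≤-trans ih (+-monoˡ-≤ _ (length-filter-∷ Q? x xs))) ⟩
  suc (length (filter Q? (x ∷ xs)) + length (filter R? xs)) ≡⟨ +-suc _ _ ⟨
  length (filter Q? (x ∷ xs)) + suc (length (filter R? xs)) ≡⟨ cong (_+_ _) (cong length (filter-accept R? rx)) ⟨
  length (filter Q? (x ∷ xs)) + length (filter R? (x ∷ xs))  ∎
  where open ≤-Reasoning

unique-all-≡⇒length≤1 : ∀ {b : A} {xs} → Unique xs → All (_≡ b) xs → length xs ≤ 1
unique-all-≡⇒length≤1 [] [] = z≤n
unique-all-≡⇒length≤1 (_ ∷ []) (_ ∷ []) = ≤-refl
unique-all-≡⇒length≤1 ((x≢y ∷ _) ∷ _) (x≡b ∷ y≡b ∷ _) = contradiction (trans x≡b (sym y≡b)) x≢y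

module ConnectedGraph {V : Set ℓ} (_≟_ : DecidableEquality V) where

  Connected : List (V × V) → V → V → Set ℓ
  Connected E = Star (SymClosure λ u v → (u , v) ∈ E)

  redirect : V → V → V → V
  redirect a b w = if does (w ≟ b) then a else w

  -- Union-find without path compression: each edge merges the classes of its
  -- endpoints, so connected vertices end up with a common representative.
  representative : List (V × V) → V → V
  representative [] w = w
  representative ((u , v) ∷ E) w = redirect (r u) (r v) (r w)
    where r = representative E

  redirect-source : ∀ a b → redirect a b b ≡ a
  redirect-source a b rewrite dec-true (b ≟ b) refl = refl

  redirect-target : ∀ a b → redirect a b a ≡ a
  redirect-target a b with does (a ≟ b)
  ... | true  = refl
  ... | false = refl

  representative-edge : ∀ {E u v} → (u , v) ∈ E → representative E u ≡ representative E v
  representative-edge (here refl)    = trans (redirect-target _ _) (sym (redirect-source _ _))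
  representative-edge (there uv∈E) = cong (redirect _ _) (representative-edge uv∈E)

  representative-connected : ∀ {E x y} → Connected E x y → representative E x ≡ representative E y
  representative-connected ε⋆              = refl
  representative-connected (fwd e ◅ path) = trans (representative-edge e) (representative-connected path)
  representative-connected (bwd e ◅ path) = trans (sym (representative-edge e)) (representative-connected path)

  fixedPoints : (V → V) → List V → List V
  fixedPoints f = filter λ w → f w ≟ w

  length-fixedPoints-id : ∀ L → length (fixedPoints id L) ≡ length L
  length-fixedPoints-id L = cong length (filter-all (λ w → w ≟ w) {L} (All.tabulate λ _ → refl))

  -- Redirecting b destroys at most the fixed point b itself.
  length-fixedPoints-redirect : ∀ f a b {L} → Unique L →
    length (fixedPoints f L) ≤ length (fixedPoints (redirect a b ∘ f) L) + 1
  length-fixedPoints-redirect f a b {L} L! = begin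
    length (fixedPoints f L)                                          ≤⟨ length-filter-⊆-∪ _ _ (_≟ b) lost⇒b L ⟩
    length (fixedPoints (redirect a b ∘ f) L) + length (filter (_≟ b) L) ≤⟨ +-monoʳ-≤ _ at-most-one ⟩
    length (fixedPoints (redirect a b ∘ f) L) + 1                        ∎
    where
    open ≤-Reasoning
    lost⇒b : ∀ {w} → f w ≡ w → redirect a b (f w) ≡ w ⊎ w ≡ b
    lost⇒b {w} fw≡w with w ≟ b
    ... | yes w≡b = inj₂ w≡b
    ... | no  w≢b rewrite fw≡w | dec-false (w ≟ b) w≢b = inj₁ refl
    at-most-one : length (filter (_≟ b) L) ≤ 1
    at-most-one = unique-all-≡⇒length≤1 (Unique.filter⁺ (_≟ b) L!) (All.all-filter (_≟ b) L)

  length-fixedPoints-constant : ∀ f c {L} → Unique L → All (λ w → f w ≡ c) L →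
                                length (fixedPoints f L) ≤ 1
  length-fixedPoints-constant f c {L} L! fL≡c = unique-all-≡⇒length≤1 (Unique.filter⁺ _ L!)
    (All.zipWith (λ (fw≡w , fw≡c) → trans (sym fw≡w) fw≡c)
      (All.all-filter _ L , All.filter⁺ _ fL≡c))

  length≤fixedPoints+edges : ∀ E {L} → Unique L →
                             length L ≤ length (fixedPoints (representative E) L) + length E
  length≤fixedPoints+edges [] {L} _ = ≤-reflexive (trans (sym (length-fixedPoints-id L)) (sym (+-identityʳ _)))
  length≤fixedPoints+edges ((u , v) ∷ E) {L} L! = begin
    length L                                                           ≤⟨ length≤fixedPoints+edges E L! ⟩
    length (fixedPoints r L) + length E                                ≤⟨ +-monoˡ-≤ _ (length-fixedPoints-redirect r (r u) (r v) L!) ⟩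
    length (fixedPoints (representative ((u , v) ∷ E)) L) + 1 + length E ≡⟨ +-assoc _ 1 (length E) ⟩
    length (fixedPoints (representative ((u , v) ∷ E)) L) + suc (length E) ∎
    where
    open ≤-Reasoning
    r = representative E

  length≤1+edges : ∀ E x {L} → Unique L → All (Connected E x) L → length L ≤ 1 + length E
  length≤1+edges E x {L} L! xL = ≤-trans (length≤fixedPoints+edges E L!)
    (+-monoˡ-≤ _ (length-fixedPoints-constant _ (representative E x) L!
      (All.map (sym ∘ representative-connected) xL)))

clearFrom : ∀ {n} → ℕ → Vertex n → Vertex n
clearFrom k       []      = []
clearFrom zero    (_ ∷ X) = false ∷ clearFrom zero X
clearFrom (suc k) (x ∷ X) = x ∷ clearFrom k X

clearFrom-⊕ : ∀ {n} k (W : Vertex n) (i : Fin n) → k ≤ toℕ i → clearFrom k (W ⊕ i) ≡ clearFrom k W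
clearFrom-⊕ zero    (_ ∷ W) Fin.zero    _         = refl
clearFrom-⊕ zero    (_ ∷ W) (Fin.suc i) _         = cong (false ∷_) (clearFrom-⊕ zero W i z≤n)
clearFrom-⊕ (suc k) (x ∷ W) (Fin.suc i) (s≤s k≤i) = cong (x ∷_) (clearFrom-⊕ k W i k≤i)

-- The vertices of Q_n lying in the subcube spanned by the first k directions.
lowCube : ℕ → (n : ℕ) → List (Vertex n)
lowCube _       zero    = [ [] ]
lowCube zero    (suc n) = map (false ∷_) (lowCube zero n)
lowCube (suc k) (suc n) = map (true ∷_) (lowCube k n) ++ map (false ∷_) (lowCube k n)

length-lowCube : ∀ k n → k ≤ n → length (lowCube k n) ≡ 2 ^ k
length-lowCube zero    zero    _         = refl
length-lowCube zero    (suc n) _         = trans (length-map _ (lowCube zero n)) (length-lowCube zero n z≤n)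
length-lowCube (suc k) (suc n) (s≤s k≤n) = begin
  length (map (true ∷_) (lowCube k n) ++ map (false ∷_) (lowCube k n)) ≡⟨ length-++ (map (true ∷_) (lowCube k n)) ⟩
  length (map (true ∷_) (lowCube k n)) + length (map (false ∷_) (lowCube k n))
    ≡⟨ cong₂ _+_ (length-map _ (lowCube k n)) (length-map _ (lowCube k n)) ⟩
  length (lowCube k n) + length (lowCube k n) ≡⟨ cong (λ m → m + m) (length-lowCube k n k≤n) ⟩
  2 ^ k + 2 ^ k                               ≡⟨ cong (_+_ (2 ^ k)) (+-identityʳ (2 ^ k)) ⟨
  2 ^ suc k                                   ∎
  where open ≡-Reasoning

lowCube-unique : ∀ k n → Unique (lowCube k n)
lowCube-unique _       zero    = [] ∷ []
lowCube-unique zero    (suc n) = Unique.map⁺ ∷-injectiveʳ (lowCube-unique zero n)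
lowCube-unique (suc k) (suc n) = Unique.++⁺ (Unique.map⁺ ∷-injectiveʳ (lowCube-unique k n))
  (Unique.map⁺ ∷-injectiveʳ (lowCube-unique k n)) disjoint
  where
  disjoint : ∀ {W} → ¬ (W ∈ map (true ∷_) (lowCube k n) × W ∈ map (false ∷_) (lowCube k n))
  disjoint (W∈true , W∈false) with ∈-map⁻ (true ∷_) W∈true | ∈-map⁻ (false ∷_) W∈false
  ... | _ , _ , refl | _ , _ , ()

clearFrom-lowCube : ∀ k n → All (λ W → clearFrom k W ≡ W) (lowCube k n)
clearFrom-lowCube _       zero    = refl ∷ []
clearFrom-lowCube zero    (suc n) = All.map⁺ (All.map (cong (false ∷_)) (clearFrom-lowCube zero n))
clearFrom-lowCube (suc k) (suc n) = All.++⁺ (All.map⁺ (All.map (cong (true ∷_)) (clearFrom-lowCube k n)))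
                                            (All.map⁺ (All.map (cong (false ∷_)) (clearFrom-lowCube k n)))

module Cube {n : ℕ} = ConnectedGraph {V = Vertex n} (≡-dec Bool._≟_)
open Cube using (Connected)

low? : ∀ {n} k → Decidable λ (e : Edge n) → toℕ (proj₂ e) < k
low? k e = toℕ (proj₂ e) <? k

projectTree : ∀ {n} → ℕ → List (Edge n) → List (Vertex n × Vertex n)
projectTree k T = map (λ (W , i) → clearFrom k W , clearFrom k (W ⊕ i)) (filter (low? k) T)

projected-edge : ∀ {n k} {T : List (Edge n)} {W i} → toℕ i < k → (W , i) ∈ T →
                 (clearFrom k W , clearFrom k (W ⊕ i)) ∈ projectTree k T
projected-edge {k = k} i<k W,i∈T = ∈-map⁺ _ (∈-filter⁺ (low? k) W,i∈T i<k)

Reach⇒Connected-projectTree : ∀ {n} k {T : List (Edge n)} {X Y} →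
  Reach (_∈ T) X Y → Connected (projectTree k T) (clearFrom k X) (clearFrom k Y)
Reach⇒Connected-projectTree k here = ε⋆
Reach⇒Connected-projectTree k {T} (step {W = W} {i = i} path W,i∈T W,i∼) with toℕ i <? k | W,i∼
... | yes i<k | inj₁ (refl , refl) = Reach⇒Connected-projectTree k path ◅◅ fwd (projected-edge i<k W,i∈T) ◅ ε⋆
... | yes i<k | inj₂ (refl , refl) = Reach⇒Connected-projectTree k path ◅◅ bwd (projected-edge i<k W,i∈T) ◅ ε⋆
... | no i≮k | inj₁ (refl , refl) = subst (Connected _ _) (sym (clearFrom-⊕ k W i (≮⇒≥ i≮k)))
  (Reach⇒Connected-projectTree k path)
... | no i≮k | inj₂ (refl , refl) = subst (Connected _ _) (clearFrom-⊕ k W i (≮⇒≥ i≮k))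
  (Reach⇒Connected-projectTree k path)

prefixSum : ∀ {n} → (Fin n → ℕ) → ℕ → ℕ
prefixSum a k = sum (tabulate λ j → if toℕ j <ᵇ k then a j else 0)

prefixSum-cong : ∀ {n} {f g : Fin n → ℕ} k → (∀ j → f j ≡ g j) → prefixSum f k ≡ prefixSum g k
prefixSum-cong k f≗g = cong sum (tabulate-cong λ j → cong (λ m → if toℕ j <ᵇ k then m else 0) (f≗g j))

sum-tabulate-zero : ∀ {n} (f : Fin n → ℕ) → (∀ j → f j ≡ 0) → sum (tabulate f) ≡ 0
sum-tabulate-zero {zero}  f f≗0 = refl
sum-tabulate-zero {suc n} f f≗0 = cong₂ _+_ (f≗0 Fin.zero) (sum-tabulate-zero (f ∘ Fin.suc) (f≗0 ∘ Fin.suc))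

sum-tabulate-+ : ∀ {n} (f g : Fin n → ℕ) → sum (tabulate λ j → f j + g j) ≡ sum (tabulate f) + sum (tabulate g)
sum-tabulate-+ {zero}  f g = refl
sum-tabulate-+ {suc n} f g = trans (cong (_+_ (f Fin.zero + g Fin.zero)) (sum-tabulate-+ (f ∘ Fin.suc) (g ∘ Fin.suc)))
  (interchange (f Fin.zero) (g Fin.zero) _ _)

if-0 : ∀ b → (if b then 0 else 0) ≡ 0
if-0 true  = refl
if-0 false = refl

prefixSum-zero : ∀ {n} k → prefixSum {n} (λ _ → 0) k ≡ 0
prefixSum-zero {n} k = sum-tabulate-zero {n} _ λ j → if-0 (toℕ j <ᵇ k)

prefixSum-+ : ∀ {n} (f g : Fin n → ℕ) k → prefixSum (λ j → f j + g j) k ≡ prefixSum f k + prefixSum g k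
prefixSum-+ {n} f g k = trans (cong sum (tabulate-cong {n = n} λ j → if-+ {f j} {g j} (toℕ j <ᵇ k))) (sum-tabulate-+ {n} _ _)
  where
  if-+ : ∀ {x y} b → (if b then x + y else 0) ≡ (if b then x else 0) + (if b then y else 0)
  if-+ true  = refl
  if-+ false = refl

prefixSum-indicator : ∀ {n} (i : Fin n) k →
  prefixSum (λ j → if does (i Fin.≟ j) then 1 else 0) k ≡ (if toℕ i <ᵇ k then 1 else 0)
prefixSum-indicator {suc n} Fin.zero    zero    = sum-tabulate-zero {n} _ λ _ → refl
prefixSum-indicator {suc n} Fin.zero    (suc k) = cong suc (sum-tabulate-zero {n} _ λ j → if-0 (toℕ j <ᵇ k))
prefixSum-indicator {suc n} (Fin.suc i) zero    = sum-tabulate-zero {n} _ λ _ → refl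
prefixSum-indicator {suc n} (Fin.suc i) (suc k) = prefixSum-indicator i k

prefixSum-suc : ∀ {n} (a : Fin n → ℕ) (t : Fin n) → prefixSum a (suc (toℕ t)) ≡ prefixSum a (toℕ t) + a t
prefixSum-suc {suc n} a Fin.zero = +-comm (a Fin.zero) _
prefixSum-suc {suc n} a (Fin.suc t) = trans (cong (_+_ (a Fin.zero)) (prefixSum-suc (a ∘ Fin.suc) t))
  (sym (+-assoc (a Fin.zero) _ _))

count-singleton : ∀ {n} (W : Vertex n) i j → count [ (W , i) ] j ≡ (if does (i Fin.≟ j) then 1 else 0)
count-singleton W i j with does (i Fin.≟ j)
... | true  = refl
... | false = refl

length-filter-low-singleton : ∀ {n} k (W : Vertex n) i →
  length (filter (low? k) [ (W , i) ]) ≡ (if toℕ i <ᵇ k then 1 else 0)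
length-filter-low-singleton k W i with toℕ i <ᵇ k
... | true  = refl
... | false = refl

prefixSum-count : ∀ {n} k (T : List (Edge n)) → prefixSum (count T) k ≡ length (filter (low? k) T)
prefixSum-count {n} k [] = prefixSum-zero {n} k
prefixSum-count k ((W , i) ∷ T) = begin
  prefixSum (count ((W , i) ∷ T)) k
    ≡⟨ prefixSum-cong k (λ j → count-++ j) ⟩
  prefixSum (λ j → count [ (W , i) ] j + count T j) k
    ≡⟨ prefixSum-+ (count [ (W , i) ]) (count T) k ⟩
  prefixSum (count [ (W , i) ]) k + prefixSum (count T) k
    ≡⟨ cong₂ _+_ singleton (prefixSum-count k T) ⟩
  length (filter (low? k) [ (W , i) ]) + length (filter (low? k) T)
    ≡⟨ length-++ (filter (low? k) [ (W , i) ]) ⟨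
  length (filter (low? k) [ (W , i) ] ++ filter (low? k) T)
    ≡⟨ cong length (filter-++ (low? k) [ (W , i) ] T) ⟨
  length (filter (low? k) ((W , i) ∷ T))
    ∎
  where
  open ≡-Reasoning
  count-++ : ∀ j → count ((W , i) ∷ T) j ≡ count [ (W , i) ] j + count T j
  count-++ j = trans (cong length (filter-++ (λ e → proj₂ e Fin.≟ j) [ (W , i) ] T))
                     (length-++ (filter (λ e → proj₂ e Fin.≟ j) [ (W , i) ]))
  singleton : prefixSum (count [ (W , i) ]) k ≡ length (filter (low? k) [ (W , i) ])
  singleton = trans (prefixSum-cong k (count-singleton W i))
    (trans (prefixSum-indicator i k) (sym (length-filter-low-singleton k W i)))

length-projectTree : ∀ {n} k (T : List (Edge n)) → length (projectTree k T) ≡ prefixSum (count T) k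
length-projectTree k T = trans (length-map _ (filter (low? k) T)) (sym (prefixSum-count k T))

signature-prefixSum : ∀ {n} {a : Fin n → ℕ} → IsSignature a → ∀ k → k ≤ n → 2 ^ k ≤ suc (prefixSum a k)
signature-prefixSum {n} {a} (T , tree , a≗count) k k≤n = begin
  2 ^ k                        ≡⟨ length-lowCube k n k≤n ⟨
  length (lowCube k n)         ≤⟨ Cube.length≤1+edges (projectTree k T) origin (lowCube-unique k n) connected ⟩
  suc (length (projectTree k T)) ≡⟨ cong suc (length-projectTree k T) ⟩
  suc (prefixSum (count T) k)  ≡⟨ cong suc (prefixSum-cong k a≗count) ⟨
  suc (prefixSum a k)          ∎
  where
  open ≤-Reasoning
  origin = clearFrom k Subset.⊥
  connected : All (Connected (projectTree k T) origin) (lowCube k n)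
  connected = All.map (λ {W} W-low → subst (Connected _ _) W-low
                        (Reach⇒Connected-projectTree k (SpanningTree.connected tree Subset.⊥ W)))
                      (clearFrom-lowCube k n)

prefixSet : ∀ {n} → ℕ → Subset n
prefixSet k = tabulate λ j → toℕ j <ᵇ k

sumOver-prefixSet : ∀ {n} k (a : Fin n → ℕ) → sumOver (prefixSet k) a ≡ prefixSum a k
sumOver-prefixSet k a = cong sum (tabulate-cong λ j → cong (λ b → if b then a j else 0) (lookup∘tabulate _ j))

∣prefixSet∣ : ∀ {n} k → k ≤ n → ∣ prefixSet {n} k ∣ ≡ k
∣prefixSet∣ {zero}  zero    _         = refl
∣prefixSet∣ {suc n} zero    _         = ∣prefixSet∣ {n} zero z≤n
∣prefixSet∣ {suc n} (suc k) (s≤s k≤n) = cong suc (∣prefixSet∣ k k≤n)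

prefixSet-nonempty : ∀ {n} k → 0 < k → 0 < n → Nonempty (prefixSet {n} k)
prefixSet-nonempty {suc n} (suc k) _ _ = Fin.zero , here

prefixSet-≢⊤ : ∀ {n} k → k < n → prefixSet {n} k ≢ ⊤
prefixSet-≢⊤ {suc n} zero    _         ()
prefixSet-≢⊤ {suc n} (suc k) (s≤s k<n) eq = prefixSet-≢⊤ k k<n (∷-injectiveʳ eq)

suc[2^k∸1]≡2^k : ∀ k → suc (2 ^ k ∸ 1) ≡ 2 ^ k
suc[2^k∸1]≡2^k k = trans (+-comm 1 (2 ^ k ∸ 1)) (m∸n+n≡m (m^n>0 2 k))

-- Irreducibility, applied to the prefix {1, …, k}, rules out equality in signature-prefixSum.
irreducible-prefixSum : ∀ {n} {a : Fin n → ℕ} → IsSignature a → Irreducible a →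
                        ∀ k → 0 < k → k < n → 2 ^ k ≤ prefixSum a k
irreducible-prefixSum {n} {a} sig irr k 0<k k<n =
  subst (_≤ prefixSum a k) (suc[2^k∸1]≡2^k k) (≤∧≢⇒< 2^k∸1≤ 2^k∸1≢)
  where
  2^k∸1≤ : 2 ^ k ∸ 1 ≤ prefixSum a k
  2^k∸1≤ = s≤s⁻¹ (subst (_≤ suc (prefixSum a k)) (sym (suc[2^k∸1]≡2^k k)) (signature-prefixSum sig k (<⇒≤ k<n)))
  2^k∸1≢ : 2 ^ k ∸ 1 ≢ prefixSum a k
  2^k∸1≢ eq = irr (prefixSet k) (prefixSet-nonempty k 0<k (≤-<-trans z≤n k<n)) (prefixSet-≢⊤ k k<n) (begin
    sumOver (prefixSet k) a       ≡⟨ sumOver-prefixSet k a ⟩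
    prefixSum a k                 ≡⟨ eq ⟨
    2 ^ k ∸ 1                     ≡⟨ cong (λ m → 2 ^ m ∸ 1) (∣prefixSet∣ k (<⇒≤ k<n)) ⟨
    2 ^ ∣ prefixSet {n} k ∣ ∸ 1   ∎)
    where open ≡-Reasoning

-- With P = 2^(m+1): a total of at most 3P + 1 cannot reach 4P − 1 unless P = 2,
-- and then the extra hypothesis asks for 8 ≤ 7.
no-room : ∀ m q → q ≤ 3 * 2 ^ suc m + 1 → 2 ^ suc (suc (suc m)) ≤ suc q → (m ≡ 0 → 8 ≤ q) → ⊥
no-room zero    q q≤7 _ 8≤q = 1+n≰n (≤-trans (8≤q refl) q≤7)
no-room (suc m) q q≤3P+1 4P≤1+q _ = 1+n≰n (≤-trans 4≤P (+-cancelˡ-≤ (3 * P) P 3 3P+P≤3P+3))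
  where
  P = 2 ^ suc (suc m)
  4≤P : 4 ≤ P
  4≤P = *-monoʳ-≤ 2 (*-monoʳ-≤ 2 (m^n>0 2 m))
  4P≡3P+P : ∀ P → 2 * (2 * P) ≡ 3 * P + P
  4P≡3P+P = solve-∀
  3P+P≤3P+3 : 3 * P + P ≤ 3 * P + 3
  3P+P≤3P+3 = begin
    3 * P + P     ≡⟨ 4P≡3P+P P ⟨
    2 * (2 * P)   ≤⟨ 4P≤1+q ⟩
    suc q         ≤⟨ s≤s q≤3P+1 ⟩
    suc (3 * P + 1) ≡⟨ +-suc (3 * P) 1 ⟨
    3 * P + 2     ≤⟨ +-monoʳ-≤ (3 * P) (n≤1+n 2) ⟩
    3 * P + 3     ∎
    where open ≤-Reasoning

small-step⇒prefixSum≢2^ : ∀ {n} {a : Fin n → ℕ} → 4 ≤ n → IsSignature a → Irreducible a →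
  (j j' : Fin n) → 1 ≤ toℕ j → toℕ j' ≡ suc (toℕ j) → a j' ≤ a j + 1 →
  prefixSum a (suc (toℕ j)) ≢ 2 ^ suc (toℕ j)
small-step⇒prefixSum≢2^ {n} {a} 4≤n sig irr j@(Fin.suc t) j' _ j'≡j+1 a[j']≤a[j]+1 tight =
  no-room m q q≤3P+1 (signature-prefixSum sig (3 + m) (subst (_< n) j'≡j+1 (toℕ<n j'))) 8≤q
  where
  m = toℕ t
  P = 2 ^ suc m
  x = prefixSum a (suc m)
  q = prefixSum a (3 + m)
  P≤x : P ≤ x
  P≤x = irreducible-prefixSum sig irr (suc m) (s≤s z≤n) (<-trans (n<1+n (suc m)) (subst (_< n) j'≡j+1 (toℕ<n j')))
  x+a[j]≡2P : x + a j ≡ P + P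
  x+a[j]≡2P = trans (sym (prefixSum-suc a j)) (trans tight (cong (_+_ P) (+-identityʳ P)))
  a[j]≤P : a j ≤ P
  a[j]≤P = +-cancelˡ-≤ P (a j) P (≤-trans (+-monoˡ-≤ (a j) P≤x) (≤-reflexive x+a[j]≡2P))
  q≡2P+a[j'] : q ≡ (P + P) + a j'
  q≡2P+a[j'] = begin
    q                                   ≡⟨ subst (λ i → prefixSum a (suc i) ≡ prefixSum a i + a j') j'≡j+1 (prefixSum-suc a j') ⟩
    prefixSum a (suc (suc m)) + a j'    ≡⟨ cong (_+ a j') (trans (prefixSum-suc a j) x+a[j]≡2P) ⟩
    (P + P) + a j'                      ∎
    where open ≡-Reasoning
  q≤3P+1 : q ≤ 3 * P + 1
  q≤3P+1 = begin
    q                ≡⟨ q≡2P+a[j'] ⟩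
    (P + P) + a j'   ≤⟨ +-monoʳ-≤ (P + P) (≤-trans a[j']≤a[j]+1 (+-monoˡ-≤ 1 a[j]≤P)) ⟩
    (P + P) + (P + 1) ≡⟨ 2P+[P+1]≡3P+1 P ⟩
    3 * P + 1        ∎
    where
    open ≤-Reasoning
    2P+[P+1]≡3P+1 : ∀ P → (P + P) + (P + 1) ≡ 3 * P + 1
    2P+[P+1]≡3P+1 = solve-∀
  8≤q : m ≡ 0 → 8 ≤ q
  8≤q m≡0 = subst (λ i → 8 ≤ prefixSum a (3 + i)) (sym m≡0) (irreducible-prefixSum sig irr 3 (s≤s z≤n) 4≤n)

2≤ε : ∀ {n} (a : Fin n → ℕ) k → suc (2 ^ k) ≤ prefixSum a k → + 2 ℤ.≤ ε a k
2≤ε a k 2^k<p = subst (+ 2 ℤ.≤_) (sym (trans (ℤP.m-n≡m⊖n p d) (ℤP.⊖-≥ (m+n≤o⇒n≤o 2 2+d≤p))))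
                  (ℤ.+≤+ (m+n≤o⇒m≤o∸n 2 2+d≤p))
  where
  p = prefixSum a k
  d = 2 ^ k ∸ 1
  2+d≤p : 2 + d ≤ p
  2+d≤p = subst (λ s → suc s ≤ p) (sym (suc[2^k∸1]≡2^k k)) 2^k<p

lemma5p8 : ∀ (n : ℕ) → 4 ≤ n → (a : Fin n → ℕ) →
    IsSignature a → Ordered a → Irreducible a →
    (j j' : Fin n) → 1 ≤ toℕ j → toℕ j' ≡ suc (toℕ j) →
    a j' ∸ a j ≤ 1 →
    (+ 2) ℤ.≤ ε a (suc (toℕ j))
lemma5p8 n 4≤n a sig _ irr j j' 1≤j j'≡j+1 a[j']∸a[j]≤1 =
  2≤ε a (suc (toℕ j)) (≤∧≢⇒< 2^i≤p (λ 2^i≡p → small-step⇒prefixSum≢2^ 4≤n sig irr j j' 1≤j j'≡j+1 a[j']≤a[j]+1 (sym 2^i≡p)))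
  where
  2^i≤p : 2 ^ suc (toℕ j) ≤ prefixSum a (suc (toℕ j))
  2^i≤p = irreducible-prefixSum sig irr (suc (toℕ j)) (s≤s z≤n) (subst (_< n) j'≡j+1 (toℕ<n j'))
  a[j']≤a[j]+1 : a j' ≤ a j + 1
  a[j']≤a[j]+1 = ≤-trans (m≤n+m∸n (a j') (a j)) (+-monoʳ-≤ (a j) a[j']∸a[j]≤1)
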